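{- For integer posets $\prec\,\in\mathrm{IPos}_m$ and $\lhd\,\in\mathrm{IPos}_n$, the product $F_{\prec}\cdot F_{\lhd}$ in $\mathbb{K}\mathrm{IPos}$ equals $\sum F_{\dashv}$, where $\dashv$ ranges over the interval between $\mathrm{U}(\prec,\lhd)$ and $\mathrm{O}(\prec,\lhd)$ in the weak order restricted to $\mathrm{IPos}_{m+n}$.
   Context: For $n \ge 0$ let $[n]=\{1,\dots,n\}$. An integer relation of size $n$ is a reflexive binary relation $R \subseteq [n]^2$; $\mathrm{IRel}_n$ is their set, $\mathrm{IRel}=\bigsqcup_n\mathrm{IRel}_n$. An integer poset is an antisymmetric transitive integer relation; $\mathrm{IPos}_n\subseteq\mathrm{IRel}_n$ is their set. Write $\mathrm{Inc}(R)=\{(a,b)\in R: a\le b\}$, $\mathrm{Dec}(R)=\{(b,a)\in R : a\le b\}$; the weak order is $R\le S$ iff $\mathrm{Inc}(R)\supseteq\mathrm{Inc}(S)$ and $\mathrm{Dec}(R)\subseteq\mathrm{Dec}(S)$. For $S\in\mathrm{IRel}_n$, $m\ge0$: $\overline{S}=\{(m+i,m+j):(i,j)\in S\}$, $\overline{[n]}=\{m+1,\dots,m+n\}$. For $R\in\mathrm{IRel}_m$, $S\in\mathrm{IRel}_n$: $\mathrm{U}(R,S)=R\cup\overline{S}\cup([m]\times\overline{[n]})$, $\mathrm{O}(R,S)=R\cup\overline{S}\cup(\overline{[n]}\times[m])$, and $\mathrm{Sh}(R,S)$ is the set of all $R\cup\overline{S}\cup I\cup D$ with $I\subseteq[m]\times\overline{[n]}$,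 $D\subseteq\overline{[n]}\times[m]$. $\mathbb{K}\mathrm{IPos}$ is the quotient of the algebra $\mathbb{K}\mathrm{IRel}$ (basis $F_R$, product $F_R\cdot F_S=\sum_{T\in\mathrm{Sh}(R,S)}F_T$) by the span of the $F_R$ with $R$ not a poset; $F_{\prec}$ denotes the image of $F_{\prec}$ for a poset $\prec$. Thus $F_\prec\cdot F_\lhd=\sum_{T\in\mathrm{Sh}(\prec,\lhd)\cap\mathrm{IPos}}F_T$ in $\mathbb{K}\mathrm{IPos}$. -}

module Defs where

open import Data.Nat using (ℕ; _+_)
open import Data.Fin using (Fin; splitAt; _≤_)
open import Data.Bool using (Bool; true; false)
open import Data.Sum using (_⊎_; inj₁; inj₂)
open import Data.Product using (_×_; Σ)
open import Relation.Binary.PropositionalEquality using (_≡_)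

-- A binary relation on [n], encoded on Fin n (element i of Fin n stands for i+1 ∈ [n];
-- this shift preserves the natural order). (i , j) ∈ R  iff  R i j ≡ true.
Rel : ℕ → Set
Rel n = Fin n → Fin n → Bool

IsIRel : ∀ {n} → Rel n → Set
IsIRel {n} R = (i : Fin n) → R i i ≡ true

IsIPos : ∀ {n} → Rel n → Set
IsIPos {n} R =
  IsIRel R
  × ((i j : Fin n) → R i j ≡ true → R j i ≡ true → i ≡ j)
  × ((i j k : Fin n) → R i j ≡ true → R j k ≡ true → R i k ≡ true)

-- Weak order: R ≤w S iff Inc(R) ⊇ Inc(S) and Dec(R) ⊆ Dec(S).
_≤w_ : ∀ {n} → Rel n → Rel n → Set
_≤w_ {n} R S =
  ((a b : Fin n) → a ≤ b → S a b ≡ true → R a b ≡ true)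
  × ((a b : Fin n) → b ≤ a → R a b ≡ true → S a b ≡ true)

-- R ∪ S̄ ∪ I ∪ D on [m+n], where I ⊆ [m] × \bar{[n]} and D ⊆ \bar{[n]} × [m]
-- are given by their characteristic functions (I a b : (a , m+b), D b a : (m+b , a)).
-- The four blocks are disjoint, so this is exactly the union.
glue : ∀ {m n} → Rel m → Rel n → (Fin m → Fin n → Bool) → (Fin n → Fin m → Bool)
     → Rel (m + n)
glue {m} R S I D x y with splitAt m x | splitAt m y
... | inj₁ a | inj₁ b = R a b
... | inj₂ a | inj₂ b = S a b
... | inj₁ a | inj₂ b = I a b
... | inj₂ a | inj₁ b = D a b

U : ∀ {m n} → Rel m → Rel n → Rel (m + n)
U R S = glue R S (λ _ _ → true) (λ _ _ → false)

O : ∀ {m n} → Rel m → Rel n → Rel (m + n)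
O R S = glue R S (λ _ _ → false) (λ _ _ → true)

InSh : ∀ {m n} → Rel m → Rel n → Rel (m + n) → Set
InSh {m} {n} R S T =
  Σ (Fin m → Fin n → Bool) λ I →
  Σ (Fin n → Fin m → Bool) λ D →
  ((x y : Fin (m + n)) → T x y ≡ glue R S I D x y)

{-# OPTIONS --safe #-}
-- Both sides say the same thing about T: that it restricts to R on [m] and to S̄ on
-- \bar{[n]}.  For a shuffle this is the definition, the off-diagonal blocks I and D being
-- arbitrary.  For the interval, U and O agree with R and S̄ on the diagonal blocks, so
-- T, squeezed between them in the weak order, must agree there too; off the diagonal
-- U (resp. O) is everything on increasing pairs and nothing on decreasing ones (resp.
-- the reverse), which puts no constraint on T.
module Submission where

open import Defs
open import Data.Nat using (ℕ; _+_)
import Data.Nat.Properties as ℕ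
open import Data.Fin using (Fin; toℕ; splitAt; _↑ˡ_; _↑ʳ_; _<_)
  renaming (_≤_ to _≤ᶠ_)
open import Data.Fin.Properties
  using (≤-total; toℕ<n; toℕ-↑ˡ; toℕ-↑ʳ; splitAt-↑ˡ; splitAt-↑ʳ; splitAt⁻¹-↑ˡ; splitAt⁻¹-↑ʳ)
open import Data.Bool using (Bool; true)
open import Data.Bool.Properties using (⇔→≡)
open import Data.Sum using (inj₁; inj₂)
open import Data.Product using (_×_; _,_)
open import Data.Empty using (⊥-elim)
open import Function.Bundles using (_⇔_; mk⇔)
open import Function.Construct.Composition using (_⇔-∘_)
open import Function.Construct.Symmetry using (⇔-sym)
open import Relation.Nullary using (¬_)
open import Relation.Binary.PropositionalEquality using (_≡_; refl; sym; trans; subst)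

≤w-squeeze : ∀ {k} {P T Q : Rel k} → P ≤w T → T ≤w Q →
             ∀ x y → P x y ≡ Q x y → T x y ≡ P x y
≤w-squeeze (P⊇T , P⊆T) (T⊇Q , T⊆Q) x y P≡Q with ≤-total x y
... | inj₁ x≤y = ⇔→≡ (mk⇔ (P⊇T x y x≤y) (λ p → T⊇Q x y x≤y (trans (sym P≡Q) p)))
... | inj₂ y≤x = ⇔→≡ (mk⇔ (λ t → trans P≡Q (T⊆Q x y y≤x t)) (P⊆T x y y≤x))

module _ {m n : ℕ} where

  data Side : Fin (m + n) → Set where
    left  : (a : Fin m) → Side (a ↑ˡ n)
    right : (b : Fin n) → Side (m ↑ʳ b)

  side : (x : Fin (m + n)) → Side x
  side x with splitAt m x in eq
  ... | inj₁ a = subst Side (splitAt⁻¹-↑ˡ eq) (left a)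
  ... | inj₂ b = subst Side (splitAt⁻¹-↑ʳ eq) (right b)

  ↑ˡ<↑ʳ : (a : Fin m) (b : Fin n) → a ↑ˡ n < m ↑ʳ b
  ↑ˡ<↑ʳ a b = begin-strict
    toℕ (a ↑ˡ n)  ≡⟨ toℕ-↑ˡ a n ⟩
    toℕ a         <⟨ toℕ<n a ⟩
    m             ≤⟨ ℕ.m≤m+n m (toℕ b) ⟩
    m + toℕ b     ≡⟨ toℕ-↑ʳ m b ⟨
    toℕ (m ↑ʳ b)  ∎
    where open ℕ.≤-Reasoning

  ↑ʳ≰↑ˡ : (a : Fin m) (b : Fin n) → ¬ (m ↑ʳ b ≤ᶠ a ↑ˡ n)
  ↑ʳ≰↑ˡ a b = ℕ.<⇒≱ (↑ˡ<↑ʳ a b)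

  module _ {R : Rel m} {S : Rel n} {I : Fin m → Fin n → Bool} {D : Fin n → Fin m → Bool} where

    glue-↑ˡ-↑ˡ : ∀ a b → glue R S I D (a ↑ˡ n) (b ↑ˡ n) ≡ R a b
    glue-↑ˡ-↑ˡ a b rewrite splitAt-↑ˡ m a n | splitAt-↑ˡ m b n = refl

    glue-↑ʳ-↑ʳ : ∀ a b → glue R S I D (m ↑ʳ a) (m ↑ʳ b) ≡ S a b
    glue-↑ʳ-↑ʳ a b rewrite splitAt-↑ʳ m n a | splitAt-↑ʳ m n b = refl

    glue-↑ˡ-↑ʳ : ∀ a b → glue R S I D (a ↑ˡ n) (m ↑ʳ b) ≡ I a b
    glue-↑ˡ-↑ʳ a b rewrite splitAt-↑ˡ m a n | splitAt-↑ʳ m n b = refl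

    glue-↑ʳ-↑ˡ : ∀ b a → glue R S I D (m ↑ʳ b) (a ↑ˡ n) ≡ D b a
    glue-↑ʳ-↑ˡ b a rewrite splitAt-↑ʳ m n b | splitAt-↑ˡ m a n = refl

  RestrictsTo : Rel (m + n) → Rel m → Rel n → Set
  RestrictsTo T R S = (∀ a b → T (a ↑ˡ n) (b ↑ˡ n) ≡ R a b)
                    × (∀ a b → T (m ↑ʳ a) (m ↑ʳ b) ≡ S a b)

  module _ {R : Rel m} {S : Rel n} where

    inSh⇔restrictsTo : (T : Rel (m + n)) → InSh R S T ⇔ RestrictsTo T R S
    inSh⇔restrictsTo T = mk⇔ to from
      where
      to : InSh R S T → RestrictsTo T R S
      to (I , D , T≗glue) = (λ a b → trans (T≗glue _ _) (glue-↑ˡ-↑ˡ a b))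
                          , (λ a b → trans (T≗glue _ _) (glue-↑ʳ-↑ʳ a b))

      from : RestrictsTo T R S → InSh R S T
      from (T|R , T|S) = I , D , T≗glue
        where
        I : Fin m → Fin n → Bool
        I a b = T (a ↑ˡ n) (m ↑ʳ b)
        D : Fin n → Fin m → Bool
        D b a = T (m ↑ʳ b) (a ↑ˡ n)

        T≗glue : ∀ x y → T x y ≡ glue R S I D x y
        T≗glue x y with side x | side y
        ... | left a  | left b  = trans (T|R a b) (sym (glue-↑ˡ-↑ˡ a b))
        ... | right a | right b = trans (T|S a b) (sym (glue-↑ʳ-↑ʳ a b))
        ... | left a  | right b = sym (glue-↑ˡ-↑ʳ a b)
        ... | right b | left a  = sym (glue-↑ʳ-↑ˡ b a)

    interval⇔restrictsTo : (T : Rel (m + n)) →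
                           (U R S ≤w T × T ≤w O R S) ⇔ RestrictsTo T R S
    interval⇔restrictsTo T = mk⇔ to from
      where
      to : U R S ≤w T × T ≤w O R S → RestrictsTo T R S
      to (U≤T , T≤O) = (λ a b → squeezed (a ↑ˡ n) (b ↑ˡ n) (glue-↑ˡ-↑ˡ a b) (glue-↑ˡ-↑ˡ a b))
                     , (λ a b → squeezed (m ↑ʳ a) (m ↑ʳ b) (glue-↑ʳ-↑ʳ a b) (glue-↑ʳ-↑ʳ a b))
        where
        squeezed : ∀ {r} x y → U R S x y ≡ r → O R S x y ≡ r → T x y ≡ r
        squeezed x y u o = trans (≤w-squeeze U≤T T≤O x y (trans u (sym o))) u

      from : RestrictsTo T R S → U R S ≤w T × T ≤w O R S
      from (T|R , T|S) = (U⊇T , U⊆T) , (O⊇T , O⊆T)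
        where
        T≡glue-↑ˡ-↑ˡ : ∀ {I D} a b → T (a ↑ˡ n) (b ↑ˡ n) ≡ glue R S I D (a ↑ˡ n) (b ↑ˡ n)
        T≡glue-↑ˡ-↑ˡ a b = trans (T|R a b) (sym (glue-↑ˡ-↑ˡ a b))

        T≡glue-↑ʳ-↑ʳ : ∀ {I D} a b → T (m ↑ʳ a) (m ↑ʳ b) ≡ glue R S I D (m ↑ʳ a) (m ↑ʳ b)
        T≡glue-↑ʳ-↑ʳ a b = trans (T|S a b) (sym (glue-↑ʳ-↑ʳ a b))

        U⊇T : ∀ x y → x ≤ᶠ y → T x y ≡ true → U R S x y ≡ true
        U⊇T x y x≤y t with side x | side y
        ... | left a  | left b  = trans (sym (T≡glue-↑ˡ-↑ˡ a b)) t
        ... | right a | right b = trans (sym (T≡glue-↑ʳ-↑ʳ a b)) t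
        ... | left a  | right b = glue-↑ˡ-↑ʳ a b
        ... | right b | left a  = ⊥-elim (↑ʳ≰↑ˡ a b x≤y)

        U⊆T : ∀ x y → y ≤ᶠ x → U R S x y ≡ true → T x y ≡ true
        U⊆T x y y≤x u with side x | side y
        ... | left a  | left b  = trans (T≡glue-↑ˡ-↑ˡ a b) u
        ... | right a | right b = trans (T≡glue-↑ʳ-↑ʳ a b) u
        ... | left a  | right b = ⊥-elim (↑ʳ≰↑ˡ a b y≤x)
        ... | right b | left a  with () ← trans (sym (glue-↑ʳ-↑ˡ b a)) u

        O⊇T : ∀ x y → x ≤ᶠ y → O R S x y ≡ true → T x y ≡ true
        O⊇T x y x≤y o with side x | side y
        ... | left a  | left b  = trans (T≡glue-↑ˡ-↑ˡ a b) o
        ... | right a | right b = trans (T≡glue-↑ʳ-↑ʳ a b) o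
        ... | left a  | right b with () ← trans (sym (glue-↑ˡ-↑ʳ a b)) o
        ... | right b | left a  = ⊥-elim (↑ʳ≰↑ˡ a b x≤y)

        O⊆T : ∀ x y → y ≤ᶠ x → T x y ≡ true → O R S x y ≡ true
        O⊆T x y y≤x t with side x | side y
        ... | left a  | left b  = trans (sym (T≡glue-↑ˡ-↑ˡ a b)) t
        ... | right a | right b = trans (sym (T≡glue-↑ʳ-↑ʳ a b)) t
        ... | left a  | right b = ⊥-elim (↑ʳ≰↑ˡ a b y≤x)
        ... | right b | left a  = glue-↑ʳ-↑ˡ b a

mainTheorem10 : (m n : ℕ) (R : Rel m) (S : Rel n) → IsIPos R → IsIPos S →
    (T : Rel (m + n)) → IsIPos T →
    (InSh R S T ⇔ ((U R S ≤w T) × (T ≤w O R S)))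
mainTheorem10 m n R S _ _ T _ = ⇔-sym (interval⇔restrictsTo T) ⇔-∘ inSh⇔restrictsTo T
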